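{- For each $\mathsf L\in\{\mathsf N,\mathsf{NeF},\mathsf{CoPC},\mathsf{MPC}\}$, the calculi $\mathbf{G3}_{\mathsf L}$ and $\mathbf{G3}^{Hist}_{\mathsf L}$ are equivalent: for every finite multiset $\Gamma$ and formula $\varphi$, the sequent $\Gamma\Rightarrow\varphi$ is derivable in $\mathbf{G3}_{\mathsf L}$ if and only if the history sequent $\emptyset\mid\Gamma\Rightarrow\varphi$ is derivable in $\mathbf{G3}^{Hist}_{\mathsf L}$.
   Context: Formulas are built from a countable set of propositional variables and the constant $\top$ (no $\bot$) using $\land,\lor,\to,\neg$. A sequent is $\Gamma\Rightarrow\varphi$ with $\Gamma$ a finite multiset and $\varphi$ a formula (the goal). The calculi $\mathbf{G3}_{\mathsf L}$ (no structural rules) have positive rules: (ax) $\Gamma,p\Rightarrow p$ ($p$ a propositional variable); ($\top$) $\Gamma\Rightarrow\top$; ($\to$r) from $\Gamma,\alpha\Rightarrow\beta$ infer $\Gamma\Rightarrow\alpha\to\beta$; ($\to$l) from $\Gamma,\alpha\to\beta\Rightarrow\alpha$ and $\Gamma,\beta\Rightarrow\varphi$ infer $\Gamma,\alpha\to\beta\Rightarrow\varphi$; ($\land$r) from $\Gamma\Rightarrow\alpha$, $\Gamma\Rightarrow\beta$ infer $\Gamma\Rightarrow\alpha\land\beta$; ($\land$l) from $\Gamma,\alpha,\beta\Rightarrow\varphi$ infer $\Gamma,\alpha\land\beta\Rightarrow\varphi$; ($\lor$r$_i$) from $\Gamma\Rightarrow\alpha$ (resp. $\beta$) infer $\Gamma\Rightarrow\alpha\lor\beta$;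 ($\lor$l) from $\Gamma,\alpha\Rightarrow\varphi$, $\Gamma,\beta\Rightarrow\varphi$ infer $\Gamma,\alpha\lor\beta\Rightarrow\varphi$; and negation rules (n) from $\Gamma,\neg\alpha,\beta\Rightarrow\alpha$ and $\Gamma,\neg\alpha,\alpha\Rightarrow\beta$ infer $\Gamma,\neg\alpha\Rightarrow\neg\beta$; (nef) from $\Gamma,\neg\alpha\Rightarrow\alpha$ infer $\Gamma,\neg\alpha\Rightarrow\neg\beta$; (copc) from $\Gamma,\neg\alpha,\beta\Rightarrow\alpha$ infer $\Gamma,\neg\alpha\Rightarrow\neg\beta$; (an) from $\Gamma,\alpha\Rightarrow\neg\alpha$ infer $\Gamma\Rightarrow\neg\alpha$; $\mathbf{G3}_{\mathsf N}$, $\mathbf{G3}_{\mathsf{NeF}}$, $\mathbf{G3}_{\mathsf{CoPC}}$, $\mathbf{G3}_{\mathsf{MPC}}$ use respectively (n); (n),(nef); (copc); (copc),(an). A history sequent is $\mathcal H\mid\Gamma\Rightarrow\varphi$ with $\mathcal H$ a finite set of formulas; $(\psi,\mathcal H)$ denotes $\mathcal H$ with $\psi$ added; "$\alpha\in\Gamma$" means $\alpha$ occurs in $\Gamma$. History rules (premises / conclusion, side conditions): (ax) $\mathcal H\mid\Gamma,p\Rightarrow p$; ($\top$) $\mathcal H\mid\Gamma\Rightarrow\top$; ($\to$r$_1$) $\emptyset\mid\Gamma,\alpha\Rightarrow\beta$ / $\mathcal H\mid\Gamma\Rightarrow\alpha\to\beta$ if $\alpha\notin\Gamma$; ($\to$r$_2$)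 $\mathcal H\mid\Gamma\Rightarrow\beta$ / $\mathcal H\mid\Gamma\Rightarrow\alpha\to\beta$ if $\alpha\in\Gamma$; ($\to$l) $(\varphi,\mathcal H)\mid\Gamma,\alpha\to\beta\Rightarrow\alpha$ and $\emptyset\mid\Gamma,\alpha\to\beta,\beta\Rightarrow\varphi$ / $\mathcal H\mid\Gamma,\alpha\to\beta\Rightarrow\varphi$ if $\varphi\notin\mathcal H$, $\beta\notin\Gamma$; ($\land$r) $\mathcal H\mid\Gamma\Rightarrow\alpha$ and $\mathcal H\mid\Gamma\Rightarrow\beta$ / $\mathcal H\mid\Gamma\Rightarrow\alpha\land\beta$; ($\land$l$_1$) $\emptyset\mid\Gamma,\alpha\land\beta,\alpha\Rightarrow\varphi$ / $\mathcal H\mid\Gamma,\alpha\land\beta\Rightarrow\varphi$ if $\alpha\notin\Gamma$; ($\land$l$_2$) likewise with $\beta$, if $\beta\notin\Gamma$; ($\lor$r$_i$) $\mathcal H\mid\Gamma\Rightarrow\alpha$ (resp. $\beta$) / $\mathcal H\mid\Gamma\Rightarrow\alpha\lor\beta$; ($\lor$l) $\emptyset\mid\Gamma,\alpha\lor\beta,\alpha\Rightarrow\varphi$ and $\emptyset\mid\Gamma,\alpha\lor\beta,\beta\Rightarrow\varphi$ / $\mathcal H\mid\Gamma,\alpha\lor\beta\Rightarrow\varphi$ if $\alpha,\beta\notin\Gamma$; in ($\to$l), ($\land$l$_i$), ($\lor$l) the goal $\varphi$ must be an atom, a negation or a disjunction. (n$_1$) $\emptyset\mid\Gamma,\neg\alpha,\beta\Rightarrow\alpha$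 and $\emptyset\mid\Gamma,\neg\alpha,\alpha\Rightarrow\beta$ / $\mathcal H\mid\Gamma,\neg\alpha\Rightarrow\neg\beta$ if $\beta\notin\Gamma\cup\{\neg\alpha\}$, $\alpha\notin\Gamma$; (n$_2$) $\emptyset\mid\Gamma,\neg\alpha,\beta\Rightarrow\alpha$ and $\mathcal H\mid\Gamma,\neg\alpha\Rightarrow\beta$ / same conclusion, if $\beta\notin\Gamma\cup\{\neg\alpha\}$, $\alpha\in\Gamma$; (n$_3$) $(\neg\beta,\mathcal H)\mid\Gamma,\neg\alpha\Rightarrow\alpha$ and $\emptyset\mid\Gamma,\neg\alpha,\alpha\Rightarrow\beta$ / same, if $\neg\beta\notin\mathcal H$, $\beta\in\Gamma\cup\{\neg\alpha\}$, $\alpha\notin\Gamma$; (n$_4$) $(\neg\beta,\mathcal H)\mid\Gamma,\neg\alpha\Rightarrow\alpha$ and $\mathcal H\mid\Gamma,\neg\alpha\Rightarrow\beta$ / same, if $\neg\beta\notin\mathcal H$, $\beta\in\Gamma\cup\{\neg\alpha\}$, $\alpha\in\Gamma$; (nef) $(\neg\beta,\mathcal H)\mid\Gamma,\neg\alpha\Rightarrow\alpha$ / same, if $\neg\beta\notin\mathcal H$; (copc$_1$) $\emptyset\mid\Gamma,\neg\alpha,\beta\Rightarrow\alpha$ / same, if $\beta\notin\Gamma\cup\{\neg\alpha\}$; (copc$_2$) $(\neg\beta,\mathcal H)\mid\Gamma,\neg\alpha\Rightarrow\alpha$ / same, if $\neg\beta\notin\mathcal H$, $\beta\in\Gamma\cup\{\neg\alpha\}$;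 (an) $\emptyset\mid\Gamma,\alpha\Rightarrow\neg\alpha$ / $\mathcal H\mid\Gamma\Rightarrow\neg\alpha$ if $\alpha\notin\Gamma$. ("Same" conclusion means $\mathcal H\mid\Gamma,\neg\alpha\Rightarrow\neg\beta$.) $\mathbf{G3}^{Hist}_{\mathsf L}$ consists of the positive history rules plus: for $\mathsf N$, (n$_1$)–(n$_4$); for $\mathsf{NeF}$, (n$_1$)–(n$_4$) and (nef); for $\mathsf{CoPC}$, (copc$_1$),(copc$_2$); for $\mathsf{MPC}$, (copc$_1$),(copc$_2$),(an). -}

module Defs where

open import Data.Nat using (ℕ)
open import Data.List using (List; []; _∷_)
open import Data.List.Membership.Propositional using (_∈_; _∉_)
open import Data.List.Relation.Binary.Permutation.Propositional using (_↭_)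

infixr 6 _∧'_
infixr 5 _∨'_
infixr 4 _⇒'_

data Formula : Set where
  var  : ℕ → Formula
  top  : Formula
  _∧'_ : Formula → Formula → Formula
  _∨'_ : Formula → Formula → Formula
  _⇒'_ : Formula → Formula → Formula
  neg  : Formula → Formula

data Logic : Set where
  N NeF CoPC MPC : Logic

data HasN : Logic → Set where
  N-N   : HasN N
  N-NeF : HasN NeF

data HasNef : Logic → Set where
  nef-NeF : HasNef NeF

data HasCopc : Logic → Set where
  copc-CoPC : HasCopc CoPC
  copc-MPC  : HasCopc MPC

data HasAn : Logic → Set where
  an-MPC : HasAn MPC

data LeftGoal : Formula → Set where
  lg-var : ∀ p → LeftGoal (var p)
  lg-neg : ∀ α → LeftGoal (neg α)
  lg-or  : ∀ α β → LeftGoal (α ∨' β)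

-- Contexts are finite multisets, represented by lists modulo permutation.
-- "Γ , α" is written α ∷ Γ; the rule `exch` identifies contexts that are
-- the same multiset (it is not a structural rule, only the multiset identity).

data G3 (L : Logic) : List Formula → Formula → Set where
  exch : ∀ {Γ Δ φ} → Γ ↭ Δ → G3 L Γ φ → G3 L Δ φ
  ax   : ∀ {Γ p} → G3 L (var p ∷ Γ) (var p)
  ⊤r   : ∀ {Γ} → G3 L Γ top
  →r   : ∀ {Γ α β} → G3 L (α ∷ Γ) β → G3 L Γ (α ⇒' β)
  →l   : ∀ {Γ α β φ} → G3 L ((α ⇒' β) ∷ Γ) α → G3 L (β ∷ Γ) φ →
         G3 L ((α ⇒' β) ∷ Γ) φ
  ∧r   : ∀ {Γ α β} → G3 L Γ α → G3 L Γ β → G3 L Γ (α ∧' β)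
  ∧l   : ∀ {Γ α β φ} → G3 L (β ∷ α ∷ Γ) φ → G3 L ((α ∧' β) ∷ Γ) φ
  ∨r₁  : ∀ {Γ α β} → G3 L Γ α → G3 L Γ (α ∨' β)
  ∨r₂  : ∀ {Γ α β} → G3 L Γ β → G3 L Γ (α ∨' β)
  ∨l   : ∀ {Γ α β φ} → G3 L (α ∷ Γ) φ → G3 L (β ∷ Γ) φ → G3 L ((α ∨' β) ∷ Γ) φ
  n    : ∀ {Γ α β} → HasN L →
         G3 L (β ∷ neg α ∷ Γ) α → G3 L (α ∷ neg α ∷ Γ) β →
         G3 L (neg α ∷ Γ) (neg β)
  nef  : ∀ {Γ α β} → HasNef L →
         G3 L (neg α ∷ Γ) α → G3 L (neg α ∷ Γ) (neg β)
  copc : ∀ {Γ α β} → HasCopc L →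
         G3 L (β ∷ neg α ∷ Γ) α → G3 L (neg α ∷ Γ) (neg β)
  an   : ∀ {Γ α} → HasAn L →
         G3 L (α ∷ Γ) (neg α) → G3 L Γ (neg α)

-- The history calculus G3^Hist_L : H | Γ ⇒ φ.
-- Histories are finite sets, represented by lists (only membership and
-- adding an element are used); ∅ is [] and (ψ , H) is ψ ∷ H.
data G3H (L : Logic) : List Formula → List Formula → Formula → Set where
  exch : ∀ {H Γ Δ φ} → Γ ↭ Δ → G3H L H Γ φ → G3H L H Δ φ
  ax   : ∀ {H Γ p} → G3H L H (var p ∷ Γ) (var p)
  ⊤r   : ∀ {H Γ} → G3H L H Γ top
  →r₁  : ∀ {H Γ α β} → α ∉ Γ → G3H L [] (α ∷ Γ) β → G3H L H Γ (α ⇒' β)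
  →r₂  : ∀ {H Γ α β} → α ∈ Γ → G3H L H Γ β → G3H L H Γ (α ⇒' β)
  →l   : ∀ {H Γ α β φ} → LeftGoal φ → φ ∉ H → β ∉ Γ →
         G3H L (φ ∷ H) ((α ⇒' β) ∷ Γ) α →
         G3H L [] (β ∷ (α ⇒' β) ∷ Γ) φ →
         G3H L H ((α ⇒' β) ∷ Γ) φ
  ∧r   : ∀ {H Γ α β} → G3H L H Γ α → G3H L H Γ β → G3H L H Γ (α ∧' β)
  ∧l₁  : ∀ {H Γ α β φ} → LeftGoal φ → α ∉ Γ →
         G3H L [] (α ∷ (α ∧' β) ∷ Γ) φ → G3H L H ((α ∧' β) ∷ Γ) φ
  ∧l₂  : ∀ {H Γ α β φ} → LeftGoal φ → β ∉ Γ →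
         G3H L [] (β ∷ (α ∧' β) ∷ Γ) φ → G3H L H ((α ∧' β) ∷ Γ) φ
  ∨r₁  : ∀ {H Γ α β} → G3H L H Γ α → G3H L H Γ (α ∨' β)
  ∨r₂  : ∀ {H Γ α β} → G3H L H Γ β → G3H L H Γ (α ∨' β)
  ∨l   : ∀ {H Γ α β φ} → LeftGoal φ → α ∉ Γ → β ∉ Γ →
         G3H L [] (α ∷ (α ∨' β) ∷ Γ) φ →
         G3H L [] (β ∷ (α ∨' β) ∷ Γ) φ →
         G3H L H ((α ∨' β) ∷ Γ) φ
  n₁   : ∀ {H Γ α β} → HasN L → β ∉ (neg α ∷ Γ) → α ∉ Γ →
         G3H L [] (β ∷ neg α ∷ Γ) α → G3H L [] (α ∷ neg α ∷ Γ) β →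
         G3H L H (neg α ∷ Γ) (neg β)
  n₂   : ∀ {H Γ α β} → HasN L → β ∉ (neg α ∷ Γ) → α ∈ Γ →
         G3H L [] (β ∷ neg α ∷ Γ) α → G3H L H (neg α ∷ Γ) β →
         G3H L H (neg α ∷ Γ) (neg β)
  n₃   : ∀ {H Γ α β} → HasN L → neg β ∉ H → β ∈ (neg α ∷ Γ) → α ∉ Γ →
         G3H L (neg β ∷ H) (neg α ∷ Γ) α → G3H L [] (α ∷ neg α ∷ Γ) β →
         G3H L H (neg α ∷ Γ) (neg β)
  n₄   : ∀ {H Γ α β} → HasN L → neg β ∉ H → β ∈ (neg α ∷ Γ) → α ∈ Γ →
         G3H L (neg β ∷ H) (neg α ∷ Γ) α → G3H L H (neg α ∷ Γ) β →
         G3H L H (neg α ∷ Γ) (neg β)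
  nef  : ∀ {H Γ α β} → HasNef L → neg β ∉ H →
         G3H L (neg β ∷ H) (neg α ∷ Γ) α → G3H L H (neg α ∷ Γ) (neg β)
  copc₁ : ∀ {H Γ α β} → HasCopc L → β ∉ (neg α ∷ Γ) →
         G3H L [] (β ∷ neg α ∷ Γ) α → G3H L H (neg α ∷ Γ) (neg β)
  copc₂ : ∀ {H Γ α β} → HasCopc L → neg β ∉ H → β ∈ (neg α ∷ Γ) →
         G3H L (neg β ∷ H) (neg α ∷ Γ) α → G3H L H (neg α ∷ Γ) (neg β)
  an   : ∀ {H Γ α} → HasAn L → α ∉ Γ →
         G3H L [] (α ∷ Γ) (neg α) → G3H L H Γ (neg α)

module Submission where

-- Both calculi are compared with an auxiliary calculus Kl, a Kleene-style
-- version of G3_L: contexts behave as sets (a principal formula is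
-- referred to by membership and never removed), and derivations carry an
-- upper bound on their height.  Kl enjoys weakening, height monotonicity and
-- height-preserving inversion of ∧r and →r, and for a fixed height it is
-- decidable whether a sequent is Kl-derivable.
--
--   * G3 → Kl and G3H → Kl are direct translations.
--   * Kl → G3 replays a Kl-derivation in a context Δ that "builds" every
--     formula of the Kl-context; this invariant absorbs all contractions.
--   * Kl → G3H is the proof-search argument.  The outer induction is on the
--     number of subformulas of the end-sequent still missing from the
--     context (a premise adding a new formula restarts with empty history).
--     Inside a fixed context Γ we recurse on the height h, keeping the
--     invariant that no formula of the history is derivable from Γ in
--     height h.  Right goals are decomposed by inversion.  A left goal is
--     first brought to a derivation of least height (using decidability);
--     its last rule is then simulated by the matching G3H rule: minimality
--     is exactly what allows adding the goal to the history of the premises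
--     that keep Γ, and the invariant shows the goal is not yet in it.

open import Defs
open import Data.Empty using (⊥)
open import Data.List using (List; []; _∷_; _++_)
open import Data.List.Relation.Unary.Any using (Any; here; there; any?)
open import Data.List.Membership.Propositional using (_∈_; _∉_; find; lose)
open import Data.List.Membership.Propositional.Properties using (∈-++⁺ˡ; ∈-++⁺ʳ; ∈-++⁻; ∈-∃++)
open import Data.List.Relation.Binary.Subset.Propositional using (_⊆_)
open import Data.List.Relation.Binary.Subset.Propositional.Properties using (∷⁺ʳ; ∈-∷⁺ʳ; ⊆-reflexive-↭)
open import Data.List.Relation.Binary.Permutation.Propositional using (_↭_; refl; prep; swap; trans; ↭-sym)
open import Data.List.Relation.Binary.Permutation.Propositional.Properties using (∈-resp-↭; shift)
open import Data.Nat using (ℕ; zero; suc; _≤_; _<_; z≤n; s≤s; _⊔_) renaming (_≟_ to _≟ℕ_)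
open import Data.Nat.Properties using (≤-refl; ≤-trans; m≤m⊔n; m≤n⊔m; n≤1+n; <-≤-trans; m<n⇒m<1+n)
open import Data.Product using (_×_; _,_; ∃; proj₁; proj₂)
open import Data.Sum using (_⊎_; inj₁; inj₂)
open import Data.Unit using (⊤; tt)
open import Function using (_∘_; id)
open import Relation.Nullary using (Dec; yes; no; ¬_)
open import Relation.Nullary.Decidable using (map′; _×-dec_; _⊎-dec_)
open import Relation.Binary.PropositionalEquality using (_≡_; refl; cong; cong₂)
import Data.List.Membership.DecPropositional as DecMembership

_≟_ : (x y : Formula) → Dec (x ≡ y)
var a ≟ var b = map′ (cong var) (λ { refl → refl }) (a ≟ℕ b)
top ≟ top = yes refl
(a ∧' b) ≟ (c ∧' d) = map′ (λ (p , q) → cong₂ _∧'_ p q) (λ { refl → refl , refl }) (a ≟ c ×-dec b ≟ d)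
(a ∨' b) ≟ (c ∨' d) = map′ (λ (p , q) → cong₂ _∨'_ p q) (λ { refl → refl , refl }) (a ≟ c ×-dec b ≟ d)
(a ⇒' b) ≟ (c ⇒' d) = map′ (λ (p , q) → cong₂ _⇒'_ p q) (λ { refl → refl , refl }) (a ≟ c ×-dec b ≟ d)
neg a ≟ neg b = map′ (cong neg) (λ { refl → refl }) (a ≟ b)
var _ ≟ top = no λ ()
var _ ≟ (_ ∧' _) = no λ ()
var _ ≟ (_ ∨' _) = no λ ()
var _ ≟ (_ ⇒' _) = no λ ()
var _ ≟ neg _ = no λ ()
top ≟ var _ = no λ ()
top ≟ (_ ∧' _) = no λ ()
top ≟ (_ ∨' _) = no λ ()
top ≟ (_ ⇒' _) = no λ ()
top ≟ neg _ = no λ ()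
(_ ∧' _) ≟ var _ = no λ ()
(_ ∧' _) ≟ top = no λ ()
(_ ∧' _) ≟ (_ ∨' _) = no λ ()
(_ ∧' _) ≟ (_ ⇒' _) = no λ ()
(_ ∧' _) ≟ neg _ = no λ ()
(_ ∨' _) ≟ var _ = no λ ()
(_ ∨' _) ≟ top = no λ ()
(_ ∨' _) ≟ (_ ∧' _) = no λ ()
(_ ∨' _) ≟ (_ ⇒' _) = no λ ()
(_ ∨' _) ≟ neg _ = no λ ()
(_ ⇒' _) ≟ var _ = no λ ()
(_ ⇒' _) ≟ top = no λ ()
(_ ⇒' _) ≟ (_ ∧' _) = no λ ()
(_ ⇒' _) ≟ (_ ∨' _) = no λ ()
(_ ⇒' _) ≟ neg _ = no λ ()
neg _ ≟ var _ = no λ ()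
neg _ ≟ top = no λ ()
neg _ ≟ (_ ∧' _) = no λ ()
neg _ ≟ (_ ∨' _) = no λ ()
neg _ ≟ (_ ⇒' _) = no λ ()

open DecMembership _≟_ using (_∈?_)

hasN? : ∀ L → Dec (HasN L)
hasN? N = yes N-N
hasN? NeF = yes N-NeF
hasN? CoPC = no λ ()
hasN? MPC = no λ ()

hasNef? : ∀ L → Dec (HasNef L)
hasNef? NeF = yes nef-NeF
hasNef? N = no λ ()
hasNef? CoPC = no λ ()
hasNef? MPC = no λ ()

hasCopc? : ∀ L → Dec (HasCopc L)
hasCopc? CoPC = yes copc-CoPC
hasCopc? MPC = yes copc-MPC
hasCopc? N = no λ ()
hasCopc? NeF = no λ ()

hasAn? : ∀ L → Dec (HasAn L)
hasAn? MPC = yes an-MPC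
hasAn? N = no λ ()
hasAn? NeF = no λ ()
hasAn? CoPC = no λ ()

focus : ∀ {x : Formula} {Γ} → x ∈ Γ → ∃ λ Γ′ → (x ∷ Γ′) ↭ Γ
focus {x} x∈Γ with ys , zs , refl ← ∈-∃++ x∈Γ = ys ++ zs , ↭-sym (shift x ys zs)

∉-focus : ∀ {x y : Formula} {Γ Γ′} → (x ∷ Γ′) ↭ Γ → y ∉ Γ → y ∉ x ∷ Γ′
∉-focus p y∉Γ = y∉Γ ∘ ∈-resp-↭ p

∈-focus : ∀ {x y : Formula} {Γ Γ′} → (x ∷ Γ′) ↭ Γ → y ∈ Γ → y ∈ x ∷ Γ′
∈-focus p = ∈-resp-↭ (↭-sym p)

∈-focus-neg : ∀ {α Γ Γ′} → (neg α ∷ Γ′) ↭ Γ → α ∈ Γ → α ∈ Γ′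
∈-focus-neg p α∈Γ with ∈-focus p α∈Γ
... | here ()
... | there α∈Γ′ = α∈Γ′

exchange : ∀ {x y : Formula} {Γ} → (x ∷ y ∷ Γ) ⊆ (y ∷ x ∷ Γ)
exchange = ⊆-reflexive-↭ (swap _ _ refl)

-- The Kleene-style calculus Kl.  Kl L h Γ φ : Γ ⇒ φ has a derivation of
-- height at most h, where Γ is read as a set and principal formulas stay.

data Kl (L : Logic) : ℕ → List Formula → Formula → Set where
  ax   : ∀ {h Γ p} → var p ∈ Γ → Kl L h Γ (var p)
  ⊤r   : ∀ {h Γ} → Kl L h Γ top
  →r   : ∀ {h Γ α β} → Kl L h (α ∷ Γ) β → Kl L (suc h) Γ (α ⇒' β)
  →l   : ∀ {h Γ α β φ} → (α ⇒' β) ∈ Γ → Kl L h Γ α → Kl L h (β ∷ Γ) φ → Kl L (suc h) Γ φ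
  ∧r   : ∀ {h Γ α β} → Kl L h Γ α → Kl L h Γ β → Kl L (suc h) Γ (α ∧' β)
  ∧l   : ∀ {h Γ α β φ} → (α ∧' β) ∈ Γ → Kl L h (β ∷ α ∷ Γ) φ → Kl L (suc h) Γ φ
  ∨r₁  : ∀ {h Γ α β} → Kl L h Γ α → Kl L (suc h) Γ (α ∨' β)
  ∨r₂  : ∀ {h Γ α β} → Kl L h Γ β → Kl L (suc h) Γ (α ∨' β)
  ∨l   : ∀ {h Γ α β φ} → (α ∨' β) ∈ Γ → Kl L h (α ∷ Γ) φ → Kl L h (β ∷ Γ) φ → Kl L (suc h) Γ φ
  n    : ∀ {h Γ α β} → HasN L → neg α ∈ Γ → Kl L h (β ∷ Γ) α → Kl L h (α ∷ Γ) β → Kl L (suc h) Γ (neg β)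
  nef  : ∀ {h Γ α β} → HasNef L → neg α ∈ Γ → Kl L h Γ α → Kl L (suc h) Γ (neg β)
  copc : ∀ {h Γ α β} → HasCopc L → neg α ∈ Γ → Kl L h (β ∷ Γ) α → Kl L (suc h) Γ (neg β)
  an   : ∀ {h Γ α} → HasAn L → Kl L h (α ∷ Γ) (neg α) → Kl L (suc h) Γ (neg α)

module _ {L : Logic} where

  weaken : ∀ {h Γ Δ φ} → Γ ⊆ Δ → Kl L h Γ φ → Kl L h Δ φ
  weaken s (ax k) = ax (s k)
  weaken s ⊤r = ⊤r
  weaken s (→r d) = →r (weaken (∷⁺ʳ _ s) d)
  weaken s (→l k d e) = →l (s k) (weaken s d) (weaken (∷⁺ʳ _ s) e)
  weaken s (∧r d e) = ∧r (weaken s d) (weaken s e)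
  weaken s (∧l k d) = ∧l (s k) (weaken (∷⁺ʳ _ (∷⁺ʳ _ s)) d)
  weaken s (∨r₁ d) = ∨r₁ (weaken s d)
  weaken s (∨r₂ d) = ∨r₂ (weaken s d)
  weaken s (∨l k d e) = ∨l (s k) (weaken (∷⁺ʳ _ s) d) (weaken (∷⁺ʳ _ s) e)
  weaken s (n x k d e) = n x (s k) (weaken (∷⁺ʳ _ s) d) (weaken (∷⁺ʳ _ s) e)
  weaken s (nef x k d) = nef x (s k) (weaken s d)
  weaken s (copc x k d) = copc x (s k) (weaken (∷⁺ʳ _ s) d)
  weaken s (an x d) = an x (weaken (∷⁺ʳ _ s) d)

  absorb : ∀ {h Γ φ x} → x ∈ Γ → Kl L h (x ∷ Γ) φ → Kl L h Γ φ
  absorb x∈Γ = weaken (∈-∷⁺ʳ x∈Γ id)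

  raise : ∀ {h h′ Γ φ} → h ≤ h′ → Kl L h Γ φ → Kl L h′ Γ φ
  raise _ (ax k) = ax k
  raise _ ⊤r = ⊤r
  raise (s≤s le) (→r d) = →r (raise le d)
  raise (s≤s le) (→l k d e) = →l k (raise le d) (raise le e)
  raise (s≤s le) (∧r d e) = ∧r (raise le d) (raise le e)
  raise (s≤s le) (∧l k d) = ∧l k (raise le d)
  raise (s≤s le) (∨r₁ d) = ∨r₁ (raise le d)
  raise (s≤s le) (∨r₂ d) = ∨r₂ (raise le d)
  raise (s≤s le) (∨l k d e) = ∨l k (raise le d) (raise le e)
  raise (s≤s le) (n x k d e) = n x k (raise le d) (raise le e)
  raise (s≤s le) (nef x k d) = nef x k (raise le d)
  raise (s≤s le) (copc x k d) = copc x k (raise le d)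
  raise (s≤s le) (an x d) = an x (raise le d)

  raise₁ : ∀ {h Γ φ} → Kl L h Γ φ → Kl L (suc h) Γ φ
  raise₁ = raise (n≤1+n _)

  ∧-inv : ∀ {h Γ γ δ} → Kl L h Γ (γ ∧' δ) → Kl L h Γ γ × Kl L h Γ δ
  ∧-inv (∧r d e) = raise₁ d , raise₁ e
  ∧-inv (→l k d e) = let e₁ , e₂ = ∧-inv e in →l k d e₁ , →l k d e₂
  ∧-inv (∧l k d) = let d₁ , d₂ = ∧-inv d in ∧l k d₁ , ∧l k d₂
  ∧-inv (∨l k d e) = let d₁ , d₂ = ∧-inv d ; e₁ , e₂ = ∧-inv e in ∨l k d₁ e₁ , ∨l k d₂ e₂

  →-inv : ∀ {h Γ γ δ} → Kl L h Γ (γ ⇒' δ) → Kl L h (γ ∷ Γ) δ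
  →-inv (→r d) = raise₁ d
  →-inv (→l k d e) = →l (there k) (weaken there d) (weaken exchange (→-inv e))
  →-inv (∧l k d) = ∧l (there k) (weaken rotate (→-inv d))
    where rotate = ⊆-reflexive-↭ (trans (swap _ _ refl) (prep _ (swap _ _ refl)))
  →-inv (∨l k d e) = ∨l (there k) (weaken exchange (→-inv d)) (weaken exchange (→-inv e))

  Derivable : List Formula → Formula → Set
  Derivable Γ φ = ∃ λ h → Kl L h Γ φ

  rule₁ : ∀ {Γ₁ φ₁ Γ φ} → (∀ {h} → Kl L h Γ₁ φ₁ → Kl L (suc h) Γ φ) →
          Derivable Γ₁ φ₁ → Derivable Γ φ
  rule₁ r (h , d) = suc h , r d

  rule₂ : ∀ {Γ₁ φ₁ Γ₂ φ₂ Γ φ} → (∀ {h} → Kl L h Γ₁ φ₁ → Kl L h Γ₂ φ₂ → Kl L (suc h) Γ φ) →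
          Derivable Γ₁ φ₁ → Derivable Γ₂ φ₂ → Derivable Γ φ
  rule₂ r (h₁ , d₁) (h₂ , d₂) = suc (h₁ ⊔ h₂) , r (raise (m≤m⊔n h₁ h₂) d₁) (raise (m≤n⊔m h₁ h₂) d₂)

  weaken-Derivable : ∀ {Γ Δ φ} → Γ ⊆ Δ → Derivable Γ φ → Derivable Δ φ
  weaken-Derivable s (h , d) = h , weaken s d

  G3⇒Kl : ∀ {Γ φ} → G3 L Γ φ → Derivable Γ φ
  G3⇒Kl (exch p d) = weaken-Derivable (⊆-reflexive-↭ p) (G3⇒Kl d)
  G3⇒Kl ax = zero , ax (here refl)
  G3⇒Kl ⊤r = zero , ⊤r
  G3⇒Kl (→r d) = rule₁ →r (G3⇒Kl d)
  G3⇒Kl (→l d e) = rule₂ (λ d′ e′ → →l (here refl) d′ (weaken (∷⁺ʳ _ there) e′)) (G3⇒Kl d) (G3⇒Kl e)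
  G3⇒Kl (∧r d e) = rule₂ ∧r (G3⇒Kl d) (G3⇒Kl e)
  G3⇒Kl (∧l d) = rule₁ (λ d′ → ∧l (here refl) (weaken (∷⁺ʳ _ (∷⁺ʳ _ there)) d′)) (G3⇒Kl d)
  G3⇒Kl (∨r₁ d) = rule₁ ∨r₁ (G3⇒Kl d)
  G3⇒Kl (∨r₂ d) = rule₁ ∨r₂ (G3⇒Kl d)
  G3⇒Kl (∨l d e) = rule₂ (λ d′ e′ → ∨l (here refl) (weaken (∷⁺ʳ _ there) d′) (weaken (∷⁺ʳ _ there) e′))
                         (G3⇒Kl d) (G3⇒Kl e)
  G3⇒Kl (n x d e) = rule₂ (n x (here refl)) (G3⇒Kl d) (G3⇒Kl e)
  G3⇒Kl (nef x d) = rule₁ (nef x (here refl)) (G3⇒Kl d)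
  G3⇒Kl (copc x d) = rule₁ (copc x (here refl)) (G3⇒Kl d)
  G3⇒Kl (an x d) = rule₁ (an x) (G3⇒Kl d)

  G3H⇒Kl : ∀ {H Γ φ} → G3H L H Γ φ → Derivable Γ φ
  G3H⇒Kl (exch p d) = weaken-Derivable (⊆-reflexive-↭ p) (G3H⇒Kl d)
  G3H⇒Kl ax = zero , ax (here refl)
  G3H⇒Kl ⊤r = zero , ⊤r
  G3H⇒Kl (→r₁ _ d) = rule₁ →r (G3H⇒Kl d)
  G3H⇒Kl (→r₂ _ d) = rule₁ (→r ∘ weaken there) (G3H⇒Kl d)
  G3H⇒Kl (→l _ _ _ d e) = rule₂ (→l (here refl)) (G3H⇒Kl d) (G3H⇒Kl e)
  G3H⇒Kl (∧r d e) = rule₂ ∧r (G3H⇒Kl d) (G3H⇒Kl e)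
  G3H⇒Kl (∧l₁ _ _ d) = rule₁ (∧l (here refl) ∘ weaken there) (G3H⇒Kl d)
  G3H⇒Kl (∧l₂ _ _ d) = rule₁ (∧l (here refl) ∘ weaken (∷⁺ʳ _ there)) (G3H⇒Kl d)
  G3H⇒Kl (∨r₁ d) = rule₁ ∨r₁ (G3H⇒Kl d)
  G3H⇒Kl (∨r₂ d) = rule₁ ∨r₂ (G3H⇒Kl d)
  G3H⇒Kl (∨l _ _ _ d e) = rule₂ (∨l (here refl)) (G3H⇒Kl d) (G3H⇒Kl e)
  G3H⇒Kl (n₁ x _ _ d e) = rule₂ (n x (here refl)) (G3H⇒Kl d) (G3H⇒Kl e)
  G3H⇒Kl (n₂ x _ _ d e) = rule₂ (λ d′ e′ → n x (here refl) d′ (weaken there e′)) (G3H⇒Kl d) (G3H⇒Kl e)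
  G3H⇒Kl (n₃ x _ _ _ d e) = rule₂ (λ d′ e′ → n x (here refl) (weaken there d′) e′) (G3H⇒Kl d) (G3H⇒Kl e)
  G3H⇒Kl (n₄ x _ _ _ d e) = rule₂ (λ d′ e′ → n x (here refl) (weaken there d′) (weaken there e′))
                                   (G3H⇒Kl d) (G3H⇒Kl e)
  G3H⇒Kl (nef x _ d) = rule₁ (nef x (here refl)) (G3H⇒Kl d)
  G3H⇒Kl (copc₁ x _ d) = rule₁ (copc x (here refl)) (G3H⇒Kl d)
  G3H⇒Kl (copc₂ x _ _ d) = rule₁ (copc x (here refl) ∘ weaken there) (G3H⇒Kl d)
  G3H⇒Kl (an x _ d) = rule₁ (an x) (G3H⇒Kl d)

-- A Kl-context all of whose
-- members are built from Δ can be simulated in G3 with context Δ: a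
-- principal formula that is not literally in Δ is replaced by the component
-- it was built from, and one that is in Δ is used by the G3 rule.

data Built (Δ : List Formula) : Formula → Set where
  base : ∀ {x} → x ∈ Δ → Built Δ x
  and  : ∀ {α β} → Built Δ α → Built Δ β → Built Δ (α ∧' β)
  or₁  : ∀ {α β} → Built Δ α → Built Δ (α ∨' β)
  or₂  : ∀ {α β} → Built Δ β → Built Δ (α ∨' β)
  imp  : ∀ {α β} → Built Δ β → Built Δ (α ⇒' β)

_◁_ : List Formula → List Formula → Set
Γ ◁ Δ = ∀ {x} → x ∈ Γ → Built Δ x

infixr 5 _∷◁_

_∷◁_ : ∀ {y Γ Δ} → Built Δ y → Γ ◁ Δ → (y ∷ Γ) ◁ Δ
(b ∷◁ c) (here refl) = b
(b ∷◁ c) (there k) = c k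

Built-bind : ∀ {Δ E y} → Δ ◁ E → Built Δ y → Built E y
Built-bind f (base k) = f k
Built-bind f (and a b) = and (Built-bind f a) (Built-bind f b)
Built-bind f (or₁ a) = or₁ (Built-bind f a)
Built-bind f (or₂ b) = or₂ (Built-bind f b)
Built-bind f (imp b) = imp (Built-bind f b)

◁-⊆ : ∀ {Γ Δ E} → Δ ⊆ E → Γ ◁ Δ → Γ ◁ E
◁-⊆ s c = Built-bind (base ∘ s) ∘ c

◁-replace : ∀ {x Γ Δ Δ′ E} → (x ∷ Δ′) ↭ Δ → Built E x → Δ′ ⊆ E → Γ ◁ Δ → Γ ◁ E
◁-replace {Δ = Δ} {E = E} p bx s c = Built-bind replaced ∘ c
  where
  replaced : Δ ◁ E
  replaced k with ∈-resp-↭ (↭-sym p) k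
  ... | here refl = bx
  ... | there k′ = base (s k′)

new : ∀ {y Δ} → Built (y ∷ Δ) y
new = base (here refl)

old : ∀ {y z Δ} → Built (y ∷ z ∷ Δ) z
old = base (there (here refl))

module _ {L : Logic} where

  Kl⇒G3 : ∀ {h Γ Δ φ} → Kl L h Γ φ → Γ ◁ Δ → G3 L Δ φ
  Kl⇒G3 (ax k) c with c k
  ... | base k′ = let _ , p = focus k′ in exch p ax
  Kl⇒G3 ⊤r c = ⊤r
  Kl⇒G3 (→r d) c = →r (Kl⇒G3 d (new ∷◁ ◁-⊆ there c))
  Kl⇒G3 (∧r d e) c = ∧r (Kl⇒G3 d c) (Kl⇒G3 e c)
  Kl⇒G3 (∨r₁ d) c = ∨r₁ (Kl⇒G3 d c)
  Kl⇒G3 (∨r₂ d) c = ∨r₂ (Kl⇒G3 d c)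
  Kl⇒G3 (an x d) c = an x (Kl⇒G3 d (new ∷◁ ◁-⊆ there c))
  Kl⇒G3 (→l k d e) c with c k
  ... | imp bβ = Kl⇒G3 e (bβ ∷◁ c)
  ... | base k′ = let _ , p = focus k′ in
    exch p (→l (Kl⇒G3 d (◁-replace p new there c))
               (Kl⇒G3 e (new ∷◁ ◁-replace p (imp new) there c)))
  Kl⇒G3 (∧l k d) c with c k
  ... | and bα bβ = Kl⇒G3 d (bβ ∷◁ bα ∷◁ c)
  ... | base k′ = let _ , p = focus k′ in
    exch p (∧l (Kl⇒G3 d (new ∷◁ old ∷◁ ◁-replace p (and old new) (there ∘ there) c)))
  Kl⇒G3 (∨l k d e) c with c k
  ... | or₁ bα = Kl⇒G3 d (bα ∷◁ c)
  ... | or₂ bβ = Kl⇒G3 e (bβ ∷◁ c)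
  ... | base k′ = let _ , p = focus k′ in
    exch p (∨l (Kl⇒G3 d (new ∷◁ ◁-replace p (or₁ new) there c))
               (Kl⇒G3 e (new ∷◁ ◁-replace p (or₂ new) there c)))
  Kl⇒G3 (n x k d e) c with c k
  ... | base k′ = let _ , p = focus k′ in
    exch p (n x (Kl⇒G3 d (new ∷◁ ◁-replace p old (there ∘ there) c))
                (Kl⇒G3 e (new ∷◁ ◁-replace p old (there ∘ there) c)))
  Kl⇒G3 (nef x k d) c with c k
  ... | base k′ = let _ , p = focus k′ in
    exch p (nef x (Kl⇒G3 d (◁-replace p new there c)))
  Kl⇒G3 (copc x k d) c with c k
  ... | base k′ = let _ , p = focus k′ in
    exch p (copc x (Kl⇒G3 d (new ∷◁ ◁-replace p old (there ∘ there) c)))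

  G3H⇒G3 : ∀ {H Γ φ} → G3H L H Γ φ → G3 L Γ φ
  G3H⇒G3 d = Kl⇒G3 (proj₂ (G3H⇒Kl d)) base

module _ {L : Logic} where

  private
    into : ∀ {x H Γ Γ′ φ} → (x ∷ Γ′) ↭ Γ → G3H L H Γ φ → G3H L H (x ∷ Γ′) φ
    into p = exch (↭-sym p)

    into₁ : ∀ {x y H Γ Γ′ φ} → (x ∷ Γ′) ↭ Γ → G3H L H (y ∷ Γ) φ → G3H L H (y ∷ x ∷ Γ′) φ
    into₁ p = exch (prep _ (↭-sym p))

  axᴴ : ∀ {H Γ p} → var p ∈ Γ → G3H L H Γ (var p)
  axᴴ k = let _ , p = focus k in exch p ax

  →lᴴ : ∀ {H Γ α β φ} → LeftGoal φ → φ ∉ H → (α ⇒' β) ∈ Γ → β ∉ Γ →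
        G3H L (φ ∷ H) Γ α → G3H L [] (β ∷ Γ) φ → G3H L H Γ φ
  →lᴴ g φ∉H k β∉Γ d e = let _ , p = focus k in
    exch p (→l g φ∉H (∉-focus p β∉Γ ∘ there) (into p d) (into₁ p e))

  ∧l₁ᴴ : ∀ {H Γ α β φ} → LeftGoal φ → (α ∧' β) ∈ Γ → α ∉ Γ →
         G3H L [] (α ∷ Γ) φ → G3H L H Γ φ
  ∧l₁ᴴ g k α∉Γ d = let _ , p = focus k in exch p (∧l₁ g (∉-focus p α∉Γ ∘ there) (into₁ p d))

  ∧l₂ᴴ : ∀ {H Γ α β φ} → LeftGoal φ → (α ∧' β) ∈ Γ → β ∉ Γ →
         G3H L [] (β ∷ Γ) φ → G3H L H Γ φ
  ∧l₂ᴴ g k β∉Γ d = let _ , p = focus k in exch p (∧l₂ g (∉-focus p β∉Γ ∘ there) (into₁ p d))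

  ∨lᴴ : ∀ {H Γ α β φ} → LeftGoal φ → (α ∨' β) ∈ Γ → α ∉ Γ → β ∉ Γ →
        G3H L [] (α ∷ Γ) φ → G3H L [] (β ∷ Γ) φ → G3H L H Γ φ
  ∨lᴴ g k α∉Γ β∉Γ d e = let _ , p = focus k in
    exch p (∨l g (∉-focus p α∉Γ ∘ there) (∉-focus p β∉Γ ∘ there) (into₁ p d) (into₁ p e))

  n₁ᴴ : ∀ {H Γ α β} → HasN L → neg α ∈ Γ → β ∉ Γ → α ∉ Γ →
        G3H L [] (β ∷ Γ) α → G3H L [] (α ∷ Γ) β → G3H L H Γ (neg β)
  n₁ᴴ x k β∉Γ α∉Γ d e = let _ , p = focus k in
    exch p (n₁ x (∉-focus p β∉Γ) (∉-focus p α∉Γ ∘ there) (into₁ p d) (into₁ p e))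

  n₂ᴴ : ∀ {H Γ α β} → HasN L → neg α ∈ Γ → β ∉ Γ → α ∈ Γ →
        G3H L [] (β ∷ Γ) α → G3H L H Γ β → G3H L H Γ (neg β)
  n₂ᴴ x k β∉Γ α∈Γ d e = let _ , p = focus k in
    exch p (n₂ x (∉-focus p β∉Γ) (∈-focus-neg p α∈Γ) (into₁ p d) (into p e))

  n₃ᴴ : ∀ {H Γ α β} → HasN L → neg β ∉ H → neg α ∈ Γ → β ∈ Γ → α ∉ Γ →
        G3H L (neg β ∷ H) Γ α → G3H L [] (α ∷ Γ) β → G3H L H Γ (neg β)
  n₃ᴴ x nβ∉H k β∈Γ α∉Γ d e = let _ , p = focus k in
    exch p (n₃ x nβ∉H (∈-focus p β∈Γ) (∉-focus p α∉Γ ∘ there) (into p d) (into₁ p e))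

  n₄ᴴ : ∀ {H Γ α β} → HasN L → neg β ∉ H → neg α ∈ Γ → β ∈ Γ → α ∈ Γ →
        G3H L (neg β ∷ H) Γ α → G3H L H Γ β → G3H L H Γ (neg β)
  n₄ᴴ x nβ∉H k β∈Γ α∈Γ d e = let _ , p = focus k in
    exch p (n₄ x nβ∉H (∈-focus p β∈Γ) (∈-focus-neg p α∈Γ) (into p d) (into p e))

  nefᴴ : ∀ {H Γ α β} → HasNef L → neg β ∉ H → neg α ∈ Γ →
         G3H L (neg β ∷ H) Γ α → G3H L H Γ (neg β)
  nefᴴ x nβ∉H k d = let _ , p = focus k in exch p (nef x nβ∉H (into p d))

  copc₁ᴴ : ∀ {H Γ α β} → HasCopc L → neg α ∈ Γ → β ∉ Γ →
           G3H L [] (β ∷ Γ) α → G3H L H Γ (neg β)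
  copc₁ᴴ x k β∉Γ d = let _ , p = focus k in exch p (copc₁ x (∉-focus p β∉Γ) (into₁ p d))

  copc₂ᴴ : ∀ {H Γ α β} → HasCopc L → neg β ∉ H → neg α ∈ Γ → β ∈ Γ →
           G3H L (neg β ∷ H) Γ α → G3H L H Γ (neg β)
  copc₂ᴴ x nβ∉H k β∈Γ d = let _ , p = focus k in exch p (copc₂ x nβ∉H (∈-focus p β∈Γ) (into p d))

-- Kl-derivability at a fixed height is decidable: a derivation of height
-- suc h is one rule instance, chosen among finitely many, applied to
-- derivations of height h.
module _ {L : Logic} where

  LeftPremises : ℕ → List Formula → Formula → Formula → Set
  LeftPremises h Γ φ (α ⇒' β) = Kl L h Γ α × Kl L h (β ∷ Γ) φ
  LeftPremises h Γ φ (α ∧' β) = Kl L h (β ∷ α ∷ Γ) φ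
  LeftPremises h Γ φ (α ∨' β) = Kl L h (α ∷ Γ) φ × Kl L h (β ∷ Γ) φ
  LeftPremises h Γ φ _ = ⊥

  NegPremises : ℕ → List Formula → Formula → Formula → Set
  NegPremises h Γ β (neg α) = (HasN L × Kl L h (β ∷ Γ) α × Kl L h (α ∷ Γ) β)
                            ⊎ (HasNef L × Kl L h Γ α) ⊎ (HasCopc L × Kl L h (β ∷ Γ) α)
  NegPremises h Γ β _ = ⊥

  GoalPremises : ℕ → List Formula → Formula → Set
  GoalPremises h Γ (var p) = var p ∈ Γ
  GoalPremises h Γ top = ⊤
  GoalPremises h Γ (α ∧' β) = Kl L h Γ α × Kl L h Γ β
  GoalPremises h Γ (α ∨' β) = Kl L h Γ α ⊎ Kl L h Γ β
  GoalPremises h Γ (α ⇒' β) = Kl L h (α ∷ Γ) β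
  GoalPremises h Γ (neg β) = (HasAn L × Kl L h (β ∷ Γ) (neg β)) ⊎ Any (NegPremises h Γ β) Γ

  OneStep : ℕ → List Formula → Formula → Set
  OneStep h Γ φ = GoalPremises h Γ φ ⊎ Any (LeftPremises h Γ φ) Γ

  unfold : ∀ {h Γ φ} → Kl L (suc h) Γ φ → OneStep h Γ φ
  unfold (ax k) = inj₁ k
  unfold ⊤r = inj₁ tt
  unfold (→r d) = inj₁ d
  unfold (∧r d e) = inj₁ (d , e)
  unfold (∨r₁ d) = inj₁ (inj₁ d)
  unfold (∨r₂ d) = inj₁ (inj₂ d)
  unfold (an x d) = inj₁ (inj₁ (x , d))
  unfold (n x k d e) = inj₁ (inj₂ (lose k (inj₁ (x , d , e))))
  unfold (nef x k d) = inj₁ (inj₂ (lose k (inj₂ (inj₁ (x , d)))))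
  unfold (copc x k d) = inj₁ (inj₂ (lose k (inj₂ (inj₂ (x , d)))))
  unfold (→l k d e) = inj₂ (lose k (d , e))
  unfold (∧l k d) = inj₂ (lose k d)
  unfold (∨l k d e) = inj₂ (lose k (d , e))

  fold : ∀ {h Γ} φ → OneStep h Γ φ → Kl L (suc h) Γ φ
  fold (var p) (inj₁ k) = ax k
  fold top (inj₁ _) = ⊤r
  fold (α ∧' β) (inj₁ (d , e)) = ∧r d e
  fold (α ∨' β) (inj₁ (inj₁ d)) = ∨r₁ d
  fold (α ∨' β) (inj₁ (inj₂ d)) = ∨r₂ d
  fold (α ⇒' β) (inj₁ d) = →r d
  fold (neg β) (inj₁ (inj₁ (x , d))) = an x d
  fold (neg β) (inj₁ (inj₂ l)) with find l
  ... | neg α , k , inj₁ (x , d , e) = n x k d e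
  ... | neg α , k , inj₂ (inj₁ (x , d)) = nef x k d
  ... | neg α , k , inj₂ (inj₂ (x , d)) = copc x k d
  fold φ (inj₂ l) with find l
  ... | (α ⇒' β) , k , (d , e) = →l k d e
  ... | (α ∧' β) , k , d = ∧l k d
  ... | (α ∨' β) , k , (d , e) = ∨l k d e

  module _ {h : ℕ} (Kl-dec-h : ∀ Γ φ → Dec (Kl L h Γ φ)) where

    LeftPremises? : ∀ Γ φ x → Dec (LeftPremises h Γ φ x)
    LeftPremises? Γ φ (α ⇒' β) = Kl-dec-h Γ α ×-dec Kl-dec-h (β ∷ Γ) φ
    LeftPremises? Γ φ (α ∧' β) = Kl-dec-h (β ∷ α ∷ Γ) φ
    LeftPremises? Γ φ (α ∨' β) = Kl-dec-h (α ∷ Γ) φ ×-dec Kl-dec-h (β ∷ Γ) φ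
    LeftPremises? Γ φ (var _) = no λ ()
    LeftPremises? Γ φ top = no λ ()
    LeftPremises? Γ φ (neg _) = no λ ()

    NegPremises? : ∀ Γ β x → Dec (NegPremises h Γ β x)
    NegPremises? Γ β (neg α) = (hasN? L ×-dec Kl-dec-h (β ∷ Γ) α ×-dec Kl-dec-h (α ∷ Γ) β)
                          ⊎-dec (hasNef? L ×-dec Kl-dec-h Γ α) ⊎-dec (hasCopc? L ×-dec Kl-dec-h (β ∷ Γ) α)
    NegPremises? Γ β (var _) = no λ ()
    NegPremises? Γ β top = no λ ()
    NegPremises? Γ β (_ ∧' _) = no λ ()
    NegPremises? Γ β (_ ∨' _) = no λ ()
    NegPremises? Γ β (_ ⇒' _) = no λ ()

    GoalPremises? : ∀ Γ φ → Dec (GoalPremises h Γ φ)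
    GoalPremises? Γ (var p) = var p ∈? Γ
    GoalPremises? Γ top = yes tt
    GoalPremises? Γ (α ∧' β) = Kl-dec-h Γ α ×-dec Kl-dec-h Γ β
    GoalPremises? Γ (α ∨' β) = Kl-dec-h Γ α ⊎-dec Kl-dec-h Γ β
    GoalPremises? Γ (α ⇒' β) = Kl-dec-h (α ∷ Γ) β
    GoalPremises? Γ (neg β) = (hasAn? L ×-dec Kl-dec-h (β ∷ Γ) (neg β)) ⊎-dec any? (NegPremises? Γ β) Γ

    OneStep? : ∀ Γ φ → Dec (OneStep h Γ φ)
    OneStep? Γ φ = GoalPremises? Γ φ ⊎-dec any? (LeftPremises? Γ φ) Γ

  Kl-dec : ∀ h Γ φ → Dec (Kl L h Γ φ)
  Kl-dec zero Γ (var p) = map′ ax (λ { (ax k) → k }) (var p ∈? Γ)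
  Kl-dec zero Γ top = yes ⊤r
  Kl-dec zero Γ (_ ∧' _) = no λ ()
  Kl-dec zero Γ (_ ∨' _) = no λ ()
  Kl-dec zero Γ (_ ⇒' _) = no λ ()
  Kl-dec zero Γ (neg _) = no λ ()
  Kl-dec (suc h) Γ φ = map′ (fold φ) unfold (OneStep? (Kl-dec h) Γ φ)

data _≺_ : Formula → Formula → Set where
  ≺∧ˡ : ∀ {α β} → α ≺ (α ∧' β)
  ≺∧ʳ : ∀ {α β} → β ≺ (α ∧' β)
  ≺∨ˡ : ∀ {α β} → α ≺ (α ∨' β)
  ≺∨ʳ : ∀ {α β} → β ≺ (α ∨' β)
  ≺⇒ˡ : ∀ {α β} → α ≺ (α ⇒' β)
  ≺⇒ʳ : ∀ {α β} → β ≺ (α ⇒' β)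
  ≺neg : ∀ {α} → α ≺ neg α

SubformulaClosed : List Formula → Set
SubformulaClosed U = ∀ {x y} → y ≺ x → x ∈ U → y ∈ U

++-closed : ∀ {A B} → SubformulaClosed A → SubformulaClosed B → SubformulaClosed (A ++ B)
++-closed {A} cA cB y≺x x∈ with ∈-++⁻ A x∈
... | inj₁ x∈A = ∈-++⁺ˡ (cA y≺x x∈A)
... | inj₂ x∈B = ∈-++⁺ʳ A (cB y≺x x∈B)

mutual
  subformulas : Formula → List Formula
  subformulas x = x ∷ properSubformulas x

  properSubformulas : Formula → List Formula
  properSubformulas (var _) = []
  properSubformulas top = []
  properSubformulas (α ∧' β) = subformulas α ++ subformulas β
  properSubformulas (α ∨' β) = subformulas α ++ subformulas β
  properSubformulas (α ⇒' β) = subformulas α ++ subformulas β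
  properSubformulas (neg α) = subformulas α

≺-proper : ∀ {x y} → y ≺ x → y ∈ properSubformulas x
≺-proper ≺∧ˡ = here refl
≺-proper (≺∧ʳ {α}) = ∈-++⁺ʳ (subformulas α) (here refl)
≺-proper ≺∨ˡ = here refl
≺-proper (≺∨ʳ {α}) = ∈-++⁺ʳ (subformulas α) (here refl)
≺-proper ≺⇒ˡ = here refl
≺-proper (≺⇒ʳ {α}) = ∈-++⁺ʳ (subformulas α) (here refl)
≺-proper ≺neg = here refl

mutual
  subformulas-closed : ∀ x → SubformulaClosed (subformulas x)
  subformulas-closed x y≺z (here refl) = there (≺-proper y≺z)
  subformulas-closed x y≺z (there z∈) = there (properSubformulas-closed x y≺z z∈)

  properSubformulas-closed : ∀ x → SubformulaClosed (properSubformulas x)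
  properSubformulas-closed (var _) _ ()
  properSubformulas-closed top _ ()
  properSubformulas-closed (α ∧' β) = ++-closed (subformulas-closed α) (subformulas-closed β)
  properSubformulas-closed (α ∨' β) = ++-closed (subformulas-closed α) (subformulas-closed β)
  properSubformulas-closed (α ⇒' β) = ++-closed (subformulas-closed α) (subformulas-closed β)
  properSubformulas-closed (neg α) = subformulas-closed α

subformulasOf : List Formula → List Formula
subformulasOf [] = []
subformulasOf (x ∷ xs) = subformulas x ++ subformulasOf xs

subformulasOf-closed : ∀ xs → SubformulaClosed (subformulasOf xs)
subformulasOf-closed [] _ ()
subformulasOf-closed (x ∷ xs) = ++-closed (subformulas-closed x) (subformulasOf-closed xs)

⊆-subformulasOf : ∀ xs → xs ⊆ subformulasOf xs
⊆-subformulasOf (x ∷ xs) (here refl) = here refl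
⊆-subformulasOf (x ∷ xs) (there k) = ∈-++⁺ʳ (subformulas x) (⊆-subformulasOf xs k)

missing : List Formula → List Formula → ℕ
missing Γ [] = zero
missing Γ (x ∷ U) with x ∈? Γ
... | yes _ = missing Γ U
... | no _ = suc (missing Γ U)

missing-anti : ∀ {Γ Γ′} U → Γ ⊆ Γ′ → missing Γ′ U ≤ missing Γ U
missing-anti [] s = z≤n
missing-anti {Γ} {Γ′} (x ∷ U) s with x ∈? Γ | x ∈? Γ′
... | yes _ | yes _ = missing-anti U s
... | yes x∈Γ | no x∉Γ′ with () ← x∉Γ′ (s x∈Γ)
... | no _ | yes _ = ≤-trans (missing-anti U s) (n≤1+n _)
... | no _ | no _ = s≤s (missing-anti U s)

missing-∷ : ∀ {α Γ} U → α ∈ U → α ∉ Γ → missing (α ∷ Γ) U < missing Γ U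
missing-∷ {α} {Γ} (x ∷ U) (here refl) α∉Γ with x ∈? Γ | x ∈? (α ∷ Γ)
... | yes α∈Γ | _ with () ← α∉Γ α∈Γ
... | no _ | yes _ = s≤s (missing-anti U there)
... | no _ | no α∉αΓ with () ← α∉αΓ (here refl)
missing-∷ {α} {Γ} (x ∷ U) (there α∈U) α∉Γ with x ∈? Γ | x ∈? (α ∷ Γ)
... | yes _ | yes _ = missing-∷ U α∈U α∉Γ
... | yes x∈Γ | no x∉αΓ with () ← x∉αΓ (there x∈Γ)
... | no _ | yes _ = m<n⇒m<1+n (missing-∷ U α∈U α∉Γ)
... | no _ | no _ = s≤s (missing-∷ U α∈U α∉Γ)

module Search (L : Logic) (U : List Formula) (closed : SubformulaClosed U) where

  Complete : ℕ → Set
  Complete m = ∀ {Γ φ h} → missing Γ U < m → Γ ⊆ U → φ ∈ U → Kl L h Γ φ → G3H L [] Γ φ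

  module FixedContext (m : ℕ) (complete : Complete m) {Γ : List Formula}
                      (Γ⊆U : Γ ⊆ U) (Γ-missing : missing Γ U ≤ m) where

    extend : ∀ {α ψ h} → α ∈ U → α ∉ Γ → ψ ∈ U → Kl L h (α ∷ Γ) ψ → G3H L [] (α ∷ Γ) ψ
    extend α∈U α∉Γ = complete (<-≤-trans (missing-∷ U α∈U α∉Γ) Γ-missing) (∈-∷⁺ʳ α∈U Γ⊆U)

    HistoryOK : List Formula → ℕ → Set
    HistoryOK H h = ∀ {ψ} → ψ ∈ H → ¬ Kl L h Γ ψ

    lower : ∀ {H h} → HistoryOK H (suc h) → HistoryOK H h
    lower ok ψ∈H = ok ψ∈H ∘ raise₁

    push : ∀ {φ H h} → ¬ Kl L h Γ φ → HistoryOK H (suc h) → HistoryOK (φ ∷ H) h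
    push ¬φ ok (here refl) = ¬φ
    push ¬φ ok (there ψ∈H) = lower ok ψ∈H

    notInHistory : ∀ {φ H h} → Kl L h Γ φ → HistoryOK H h → φ ∉ H
    notInHistory d ok φ∈H = ok φ∈H d

    mutual
      search : ∀ h φ {H} → φ ∈ U → Kl L h Γ φ → HistoryOK H h → G3H L H Γ φ
      search h top φ∈U d ok = ⊤r
      search h (α ∧' β) φ∈U d ok =
        ∧r (search h α (closed ≺∧ˡ φ∈U) (proj₁ (∧-inv d)) ok)
           (search h β (closed ≺∧ʳ φ∈U) (proj₂ (∧-inv d)) ok)
      search h (α ⇒' β) φ∈U d ok with α ∈? Γ
      ... | yes α∈Γ = →r₂ α∈Γ (search h β (closed ≺⇒ʳ φ∈U) (absorb α∈Γ (→-inv d)) ok)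
      ... | no α∉Γ = →r₁ α∉Γ (extend (closed ≺⇒ˡ φ∈U) α∉Γ (closed ≺⇒ʳ φ∈U) (→-inv d))
      search h (var p) = leftGoal h (lg-var p)
      search h (neg α) = leftGoal h (lg-neg α)
      search h (α ∨' β) = leftGoal h (lg-or α β)

      leftGoal : ∀ h {φ H} → LeftGoal φ → φ ∈ U → Kl L h Γ φ → HistoryOK H h → G3H L H Γ φ
      leftGoal zero g φ∈U (ax k) ok = axᴴ k
      leftGoal (suc h) {φ} g φ∈U d ok with Kl-dec h Γ φ
      ... | yes d′ = leftGoal h g φ∈U d′ (lower ok)
      ... | no ¬d′ = lastRule g φ∈U d ¬d′ ok

      -- Premises
      -- that add a formula already in Γ are absorbed; the others either keep
      -- Γ (and are searched further) or enlarge it (outer induction).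
      lastRule : ∀ {h φ H} → LeftGoal φ → φ ∈ U → Kl L (suc h) Γ φ → ¬ Kl L h Γ φ →
                 HistoryOK H (suc h) → G3H L H Γ φ
      lastRule g φ∈U (ax k) ¬d ok = axᴴ k
      lastRule g φ∈U (∨r₁ d) ¬d ok = ∨r₁ (search _ _ (closed ≺∨ˡ φ∈U) d (lower ok))
      lastRule g φ∈U (∨r₂ d) ¬d ok = ∨r₂ (search _ _ (closed ≺∨ʳ φ∈U) d (lower ok))
      lastRule {φ = φ} g φ∈U d₀@(→l {α = α} {β} k d e) ¬d ok with β ∈? Γ
      ... | yes β∈Γ = search _ φ φ∈U (absorb β∈Γ e) (lower ok)
      ... | no β∉Γ = →lᴴ g (notInHistory d₀ ok) k β∉Γ
                       (search _ α (closed ≺⇒ˡ (Γ⊆U k)) d (push ¬d ok))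
                       (extend (closed ≺⇒ʳ (Γ⊆U k)) β∉Γ φ∈U e)
      lastRule {φ = φ} g φ∈U d₀@(∧l {α = α} {β} k d) ¬d ok with α ∈? Γ | β ∈? Γ
      ... | no α∉Γ | _ = ∧l₁ᴴ g k α∉Γ (extend (closed ≺∧ˡ (Γ⊆U k)) α∉Γ φ∈U (weaken there d₀))
      ... | yes _ | no β∉Γ = ∧l₂ᴴ g k β∉Γ (extend (closed ≺∧ʳ (Γ⊆U k)) β∉Γ φ∈U (weaken there d₀))
      ... | yes α∈Γ | yes β∈Γ = search _ φ φ∈U (weaken (∈-∷⁺ʳ β∈Γ (∈-∷⁺ʳ α∈Γ id)) d) (lower ok)
      lastRule {φ = φ} g φ∈U (∨l {α = α} {β} k d e) ¬d ok with α ∈? Γ | β ∈? Γ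
      ... | yes α∈Γ | _ = search _ φ φ∈U (absorb α∈Γ d) (lower ok)
      ... | no _ | yes β∈Γ = search _ φ φ∈U (absorb β∈Γ e) (lower ok)
      ... | no α∉Γ | no β∉Γ = ∨lᴴ g k α∉Γ β∉Γ (extend (closed ≺∨ˡ (Γ⊆U k)) α∉Γ φ∈U d)
                                              (extend (closed ≺∨ʳ (Γ⊆U k)) β∉Γ φ∈U e)
      lastRule g φ∈U d₀@(n {α = α} {β} x k d e) ¬d ok = negN (β ∈? Γ) (α ∈? Γ)
        where
        α∈U = closed ≺neg (Γ⊆U k)
        β∈U = closed ≺neg φ∈U
        negN : Dec (β ∈ Γ) → Dec (α ∈ Γ) → G3H L _ Γ (neg β)
        negN (no β∉Γ) (no α∉Γ) = n₁ᴴ x k β∉Γ α∉Γ (extend β∈U β∉Γ α∈U d) (extend α∈U α∉Γ β∈U e)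
        negN (no β∉Γ) (yes α∈Γ) = n₂ᴴ x k β∉Γ α∈Γ (extend β∈U β∉Γ α∈U d)
                                       (search _ β β∈U (absorb α∈Γ e) (lower ok))
        negN (yes β∈Γ) (no α∉Γ) = n₃ᴴ x (notInHistory d₀ ok) k β∈Γ α∉Γ
                                       (search _ α α∈U (absorb β∈Γ d) (push ¬d ok))
                                       (extend α∈U α∉Γ β∈U e)
        negN (yes β∈Γ) (yes α∈Γ) = n₄ᴴ x (notInHistory d₀ ok) k β∈Γ α∈Γ
                                        (search _ α α∈U (absorb β∈Γ d) (push ¬d ok))
                                        (search _ β β∈U (absorb α∈Γ e) (lower ok))
      lastRule g φ∈U d₀@(nef {α = α} x k d) ¬d ok =
        nefᴴ x (notInHistory d₀ ok) k (search _ α (closed ≺neg (Γ⊆U k)) d (push ¬d ok))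
      lastRule g φ∈U d₀@(copc {α = α} {β} x k d) ¬d ok with β ∈? Γ
      ... | no β∉Γ = copc₁ᴴ x k β∉Γ (extend (closed ≺neg φ∈U) β∉Γ (closed ≺neg (Γ⊆U k)) d)
      ... | yes β∈Γ = copc₂ᴴ x (notInHistory d₀ ok) k β∈Γ
                        (search _ α (closed ≺neg (Γ⊆U k)) (absorb β∈Γ d) (push ¬d ok))
      lastRule {φ = φ} g φ∈U (an {α = α} x d) ¬d ok with α ∈? Γ
      ... | no α∉Γ = an x α∉Γ (extend (closed ≺neg φ∈U) α∉Γ φ∈U d)
      ... | yes α∈Γ = search _ φ φ∈U (absorb α∈Γ d) (lower ok)

  complete : ∀ m → Complete m
  complete (suc m) (s≤s lt) Γ⊆U φ∈U d =
    FixedContext.search m (complete m) Γ⊆U lt _ _ φ∈U d (λ ())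

Kl⇒G3H : ∀ {L h Γ φ} → Kl L h Γ φ → G3H L [] Γ φ
Kl⇒G3H {L} {Γ = Γ} {φ} =
  Search.complete L U (subformulasOf-closed (φ ∷ Γ)) (suc (missing Γ U)) ≤-refl
    (⊆-subformulasOf (φ ∷ Γ) ∘ there) (⊆-subformulasOf (φ ∷ Γ) (here refl))
  where
  U = subformulasOf (φ ∷ Γ)

theorem5p4 : (L : Logic) (Γ : List Formula) (φ : Formula) →
    (G3 L Γ φ → G3H L [] Γ φ) × (G3H L [] Γ φ → G3 L Γ φ)
theorem5p4 L Γ φ = Kl⇒G3H ∘ proj₂ ∘ G3⇒Kl , G3H⇒G3
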